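{- Let $e=uv$ be an edge in a connected graph $G$. Then $\{u,v\}$ is a maximal mutual-visibility set of $G$ if and only if $e$ is a cut-edge of $G$.
   Context: A cut-edge is an edge whose removal disconnects the graph. For $X\subseteq V(G)$, two vertices $a,b$ are $X$-visible if there is a shortest $a,b$-path $P$ in $G$ with $V(P)\cap X\subseteq\{a,b\}$. A set $X$ is a mutual-visibility set if every two vertices of $X$ are $X$-visible; it is maximal if no proper superset is a mutual-visibility set. -}

module Defs where

open import Data.Nat using (ℕ; zero; suc; _≤_)
open import Data.Fin using (Fin)
open import Data.Fin.Subset using (Subset; _∈_; _⊂_)
open import Data.List using (List; []; _∷_)
open import Data.List.Relation.Unary.All using (All)
open import Data.Product using (Σ; _×_; ∃)
open import Data.Sum using (_⊎_)
open import Relation.Nullary using (¬_; Dec)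
open import Relation.Binary.PropositionalEquality using (_≡_)

record Graph (n : ℕ) : Set₁ where
  field
    Adj    : Fin n → Fin n → Set
    adj?   : ∀ x y → Dec (Adj x y)
    sym    : ∀ {x y} → Adj x y → Adj y x
    irrefl : ∀ {x} → ¬ Adj x x
open Graph public

module _ {n : ℕ} where

  data Walk (A : Fin n → Fin n → Set) : Fin n → Fin n → Set where
    [] : ∀ {x} → Walk A x x
    _∷_ : ∀ {x y z} → A x y → Walk A y z → Walk A x z

  len : ∀ {A x y} → Walk A x y → ℕ
  len []      = zero
  len (_ ∷ w) = suc (len w)

  verts : ∀ {A x y} → Walk A x y → List (Fin n)
  verts {x = x} []      = x ∷ []
  verts {x = x} (_ ∷ w) = x ∷ verts w

  -- a shortest a,b-walk (necessarily a path): no a,b-walk is shorter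
  IsShortest : ∀ {A a b} → Walk A a b → Set
  IsShortest {A} {a} {b} p = ∀ (q : Walk A a b) → len p ≤ len q

  Connected : (Fin n → Fin n → Set) → Set
  Connected A = ∀ x y → Walk A x y

  Visible : Graph n → Subset n → Fin n → Fin n → Set
  Visible G X a b =
    Σ (Walk (Adj G) a b) λ P →
      IsShortest P × All (λ z → z ∈ X → (z ≡ a ⊎ z ≡ b)) (verts P)

  IsMutualVisibility : Graph n → Subset n → Set
  IsMutualVisibility G X = ∀ a b → a ∈ X → b ∈ X → Visible G X a b

  IsMaximalMutualVisibility : Graph n → Subset n → Set
  IsMaximalMutualVisibility G X =
    IsMutualVisibility G X × (∀ Y → X ⊂ Y → ¬ IsMutualVisibility G Y)

  RemoveEdge : Graph n → Fin n → Fin n → Fin n → Fin n → Set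
  RemoveEdge G u v x y = Adj G x y × ¬ ((x ≡ u × y ≡ v) ⊎ (x ≡ v × y ≡ u))

  -- uv is a cut-edge: uv ∈ E(G) and G − uv is disconnected
  -- (G itself is assumed connected in the statement)
  IsCutEdge : Graph n → Fin n → Fin n → Set
  IsCutEdge G u v = Adj G u v × ¬ Connected (RemoveEdge G u v)

-- If G − uv is disconnected, a third vertex w of a mutual-visibility set Y ⊇ {u, v}
-- would give a u,w-geodesic avoiding v and a w,v-geodesic avoiding u, hence a u,v-walk
-- avoiding the edge uv; so {u, v} is maximal.  Conversely, if G − uv is connected, a
-- u,v-walk in G − uv crosses from the vertices strictly closer to u than to v into the
-- rest along some edge xy.  Then d(v, y) ≤ d(u, y), so a v,y-geodesic avoids u, and a
-- u,y-geodesic avoiding v is either any u,y-geodesic or a u,x-geodesic followed by xy;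
-- hence {u, v, y} is a larger mutual-visibility set.
module Submission where

open import Defs
open import Data.Nat using (ℕ; zero; suc; _≤_; _<_; z≤n; s≤s; _≤?_; _<?_)
open import Data.Nat.Properties
  using (≤-trans; n≤1+n; <-irrefl; ≤-reflexive; <⇒≤; ≮⇒≥; ≰⇒>; n≮0; n≤0⇒n≡0; n<1⇒n≡0; n≢0⇒n>0
        ; suc-injective; anyUpTo?; module ≤-Reasoning)
open import Data.Nat.Induction using (<-wellFounded)
open import Induction.WellFounded using (Acc; acc)
open import Data.Fin using (Fin; _≟_)
open import Data.Fin.Properties using (any?)
open import Data.Fin.Subset using (Subset; ⁅_⁆; _∪_; _∈_; _⊂_)
open import Data.Fin.Subset.Properties using (x∈⁅y⁆⇒x≡y; x∈⁅x⁆; x∈p∪q⁻; x∈p∪q⁺; p⊆p∪q)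
open import Data.List.Relation.Unary.All as All using (All; []; _∷_)
open import Data.Product as Prod using (Σ; ∃; ∃₂; _×_; _,_; proj₁; proj₂)
open import Data.Sum as Sum using (_⊎_; inj₁; inj₂)
open import Data.Empty using (⊥-elim)
open import Function.Base using (_∘_)
open import Function.Bundles using (_⇔_; mk⇔)
open import Relation.Nullary using (¬_; Dec; yes; no)
open import Relation.Nullary.Decidable using (_×-dec_; _⊎-dec_)
open import Relation.Binary.PropositionalEquality as ≡ using (_≡_; _≢_; refl; cong; ≢-sym)

module _ {n : ℕ} {A : Fin n → Fin n → Set} where

  infixr 5 _++ʷ_

  _++ʷ_ : ∀ {a b c} → Walk A a b → Walk A b c → Walk A a c
  [] ++ʷ q = q
  (e ∷ p) ++ʷ q = e ∷ (p ++ʷ q)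

  len-snoc : ∀ {a b c} (p : Walk A a b) (e : A b c) → len (p ++ʷ (e ∷ [])) ≡ suc (len p)
  len-snoc [] e = refl
  len-snoc (_ ∷ p) e = cong suc (len-snoc p e)

  len≡0⇒≡ : ∀ {a b} (p : Walk A a b) → len p ≡ 0 → a ≡ b
  len≡0⇒≡ [] _ = refl

  All-head : ∀ {P : Fin n → Set} {a b} (p : Walk A a b) → All P (verts p) → P a
  All-head [] (pa ∷ _) = pa
  All-head (_ ∷ _) (pa ∷ _) = pa

  All-++ : ∀ {P : Fin n → Set} {a b c} (p : Walk A a b) (q : Walk A b c) →
    All P (verts p) → All P (verts q) → All P (verts (p ++ʷ q))
  All-++ [] q _ all-q = all-q
  All-++ (_ ∷ p) q (pa ∷ all-p) all-q = pa ∷ All-++ p q all-p all-q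

  -- If p passed through c, its tail from c would be a strictly shorter walk from c.
  no-longer-than-walks-from⇒avoids : ∀ {a b c} (p : Walk A a b) → a ≢ c →
    (∀ (q : Walk A c b) → len p ≤ len q) → All (_≢ c) (verts p)
  no-longer-than-walks-from⇒avoids [] a≢c _ = a≢c ∷ []
  no-longer-than-walks-from⇒avoids {c = c} (_∷_ {y = y} _ p) a≢c p-short =
    a≢c ∷ no-longer-than-walks-from⇒avoids p next≢c (λ q → ≤-trans (n≤1+n (len p)) (p-short q))
    where
    next≢c : y ≢ c
    next≢c refl = <-irrefl refl (p-short p)

  crossing-edge : ∀ {P : Fin n → Set} → (∀ x → Dec (P x)) → ∀ {a b} → Walk A a b →
    P a → ¬ P b → ∃₂ λ x y → A x y × P x × ¬ P y
  crossing-edge P? [] Pa ¬Pb = ⊥-elim (¬Pb Pa)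
  crossing-edge P? (_∷_ {y = y} e p) Pa ¬Pb with P? y
  ... | yes Py = crossing-edge P? p Py ¬Pb
  ... | no ¬Py = _ , _ , e , Pa , ¬Py

  module _ (sym-A : ∀ {x y} → A x y → A y x) where

    reverse : ∀ {a b} → Walk A a b → Walk A b a
    reverse [] = []
    reverse (e ∷ p) = reverse p ++ʷ (sym-A e ∷ [])

    len-reverse : ∀ {a b} (p : Walk A a b) → len (reverse p) ≡ len p
    len-reverse [] = refl
    len-reverse (e ∷ p) = ≡.trans (len-snoc (reverse p) (sym-A e)) (cong suc (len-reverse p))

    All-reverse : ∀ {P : Fin n → Set} {a b} (p : Walk A a b) →
      All P (verts p) → All P (verts (reverse p))
    All-reverse [] all-p = all-p
    All-reverse (e ∷ p) (pa ∷ all-p) =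
      All-++ (reverse p) _ (All-reverse p all-p) (All-head p all-p ∷ pa ∷ [])

    IsShortest-reverse : ∀ {a b} (p : Walk A a b) → IsShortest p → IsShortest (reverse p)
    IsShortest-reverse p p-shortest q = begin
      len (reverse p) ≡⟨ len-reverse p ⟩
      len p           ≤⟨ p-shortest (reverse q) ⟩
      len (reverse q) ≡⟨ len-reverse q ⟩
      len q           ∎
      where open ≤-Reasoning

  module _ (A? : ∀ x y → Dec (A x y)) where

    walkOfLength? : ∀ k a b → Dec (∃ λ (p : Walk A a b) → len p ≡ k)
    walkOfLength? zero a b with a ≟ b
    ... | yes refl = yes ([] , refl)
    ... | no a≢b = no λ { ([] , _) → a≢b refl ; (_ ∷ _ , ()) }
    walkOfLength? (suc k) a b with any? (λ c → A? a c ×-dec walkOfLength? k c b)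
    ... | yes (_ , e , p , refl) = yes (e ∷ p , refl)
    ... | no ∄ = no λ { ([] , ()) ; (e ∷ p , eq) → ∄ (_ , e , p , suc-injective eq) }

    shortest : ∀ {a b} → Walk A a b → Σ (Walk A a b) IsShortest
    shortest p = shorten p (<-wellFounded (len p))
      where
      shorten : ∀ {a b} (p : Walk A a b) → Acc _<_ (len p) → Σ (Walk A a b) IsShortest
      shorten {a} {b} p (acc rs) with anyUpTo? (λ k → walkOfLength? k a b) (len p)
      ... | yes (_ , k<len-p , q , refl) = shorten q (rs k<len-p)
      ... | no ∄ = p , λ q → ≮⇒≥ λ q<p → ∄ (len q , q<p , q , refl)

∈-pair⁻ : ∀ {n} {u v a : Fin n} → a ∈ ⁅ u ⁆ ∪ ⁅ v ⁆ → a ≡ u ⊎ a ≡ v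
∈-pair⁻ {u = u} {v} = Sum.map (x∈⁅y⁆⇒x≡y u) (x∈⁅y⁆⇒x≡y v) ∘ x∈p∪q⁻ ⁅ u ⁆ ⁅ v ⁆

∈-pairˡ : ∀ {n} {u v : Fin n} → u ∈ ⁅ u ⁆ ∪ ⁅ v ⁆
∈-pairˡ {u = u} = x∈p∪q⁺ (inj₁ (x∈⁅x⁆ u))

∈-pairʳ : ∀ {n} {u v : Fin n} → v ∈ ⁅ u ⁆ ∪ ⁅ v ⁆
∈-pairʳ {v = v} = x∈p∪q⁺ (inj₂ (x∈⁅x⁆ v))

module _ {n} (G : Graph n) where

  Visible-refl : ∀ {X} a → Visible G X a a
  Visible-refl a = [] , (λ _ → z≤n) , ((λ _ → inj₁ refl) ∷ [])

  Visible-sym : ∀ {X a b} → Visible G X a b → Visible G X b a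
  Visible-sym (p , p-shortest , p-sees) =
    reverse (sym G) p ,
    IsShortest-reverse (sym G) p p-shortest ,
    All-reverse (sym G) p (All.map (Sum.swap ∘_) p-sees)

  Visible-adjacent : ∀ {X a b} → Adj G a b → Visible G X a b
  Visible-adjacent ab =
    ab ∷ [] ,
    (λ { [] → ⊥-elim (irrefl G ab) ; (_ ∷ _) → s≤s z≤n }) ,
    ((λ _ → inj₁ refl) ∷ (λ _ → inj₂ refl) ∷ [])

  Visible-avoiding : ∀ {X a b c} (p : Walk (Adj G) a b) → IsShortest p →
    All (_≢ c) (verts p) → (∀ {z} → z ∈ X → z ≢ c → z ≡ a ⊎ z ≡ b) → Visible G X a b
  Visible-avoiding p p-shortest p-avoids X∖c⊆ab =
    p , p-shortest , All.map (λ z≢c z∈X → X∖c⊆ab z∈X z≢c) p-avoids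

  pair-visible : ∀ {u v X a b} → Adj G u v →
    a ∈ ⁅ u ⁆ ∪ ⁅ v ⁆ → b ∈ ⁅ u ⁆ ∪ ⁅ v ⁆ → Visible G X a b
  pair-visible uv a∈ b∈ with ∈-pair⁻ a∈ | ∈-pair⁻ b∈
  ... | inj₁ refl | inj₁ refl = Visible-refl _
  ... | inj₁ refl | inj₂ refl = Visible-adjacent uv
  ... | inj₂ refl | inj₁ refl = Visible-adjacent (sym G uv)
  ... | inj₂ refl | inj₂ refl = Visible-refl _

  IsMutualVisibility-∪⁅⁆ : ∀ {X y} →
    (∀ {a b} → a ∈ X → b ∈ X → Visible G (X ∪ ⁅ y ⁆) a b) →
    (∀ {a} → a ∈ X → Visible G (X ∪ ⁅ y ⁆) a y) →
    IsMutualVisibility G (X ∪ ⁅ y ⁆)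
  IsMutualVisibility-∪⁅⁆ {X} {y} X-visible y-visible a b a∈ b∈
    with x∈p∪q⁻ X ⁅ y ⁆ a∈ | x∈p∪q⁻ X ⁅ y ⁆ b∈
  ... | inj₁ a∈X | inj₁ b∈X = X-visible a∈X b∈X
  ... | inj₁ a∈X | inj₂ b∈y rewrite x∈⁅y⁆⇒x≡y y b∈y = y-visible a∈X
  ... | inj₂ a∈y | inj₁ b∈X rewrite x∈⁅y⁆⇒x≡y y a∈y = Visible-sym (y-visible b∈X)
  ... | inj₂ a∈y | inj₂ b∈y rewrite x∈⁅y⁆⇒x≡y y a∈y | x∈⁅y⁆⇒x≡y y b∈y = Visible-refl y

  module _ {u v : Fin n} where

    RemoveEdge-sym : ∀ {x y} → RemoveEdge G u v x y → RemoveEdge G u v y x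
    RemoveEdge-sym (xy , xy≢uv) = sym G xy , xy≢uv ∘ Sum.swap ∘ Sum.map Prod.swap Prod.swap

    edge-avoiding-endpoint : ∀ {c x y} → c ≡ u ⊎ c ≡ v → x ≢ c → y ≢ c →
      ¬ ((x ≡ u × y ≡ v) ⊎ (x ≡ v × y ≡ u))
    edge-avoiding-endpoint (inj₁ refl) x≢c _ (inj₁ (x≡u , _)) = x≢c x≡u
    edge-avoiding-endpoint (inj₁ refl) _ y≢c (inj₂ (_ , y≡u)) = y≢c y≡u
    edge-avoiding-endpoint (inj₂ refl) _ y≢c (inj₁ (_ , y≡v)) = y≢c y≡v
    edge-avoiding-endpoint (inj₂ refl) x≢c _ (inj₂ (x≡v , _)) = x≢c x≡v

    avoiding-endpoint⇒RemoveEdge : ∀ {a b c} → c ≡ u ⊎ c ≡ v → (p : Walk (Adj G) a b) →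
      All (_≢ c) (verts p) → Walk (RemoveEdge G u v) a b
    avoiding-endpoint⇒RemoveEdge c-end [] _ = []
    avoiding-endpoint⇒RemoveEdge c-end (e ∷ p) (x≢c ∷ p-avoids) =
      (e , edge-avoiding-endpoint c-end x≢c (All-head p p-avoids)) ∷
      avoiding-endpoint⇒RemoveEdge c-end p p-avoids

    Visible⇒RemoveEdge-walk : ∀ {Y a b c} → c ≡ u ⊎ c ≡ v → c ∈ Y → c ≢ a → c ≢ b →
      Visible G Y a b → Walk (RemoveEdge G u v) a b
    Visible⇒RemoveEdge-walk c-end c∈Y c≢a c≢b (p , _ , p-sees) =
      avoiding-endpoint⇒RemoveEdge c-end p
        (All.map (λ { sees refl → Sum.[ c≢a , c≢b ] (sees c∈Y) }) p-sees)

    RemoveEdge-connected : Connected (Adj G) → Walk (RemoveEdge G u v) u v →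
      Connected (RemoveEdge G u v)
    RemoveEdge-connected connected bypass x y = reroute (connected x y)
      where
      reroute : ∀ {a b} → Walk (Adj G) a b → Walk (RemoveEdge G u v) a b
      reroute [] = []
      reroute (_∷_ {a} {b} e p) with ((a ≟ u) ×-dec (b ≟ v)) ⊎-dec ((a ≟ v) ×-dec (b ≟ u))
      ... | yes (inj₁ (refl , refl)) = bypass ++ʷ reroute p
      ... | yes (inj₂ (refl , refl)) = reverse RemoveEdge-sym bypass ++ʷ reroute p
      ... | no ab≢uv = (e , ab≢uv) ∷ reroute p

    mutual-visibility-bypass : ∀ {Y w} → IsMutualVisibility G Y → u ∈ Y → v ∈ Y → w ∈ Y →
      u ≢ v → w ≢ u → w ≢ v → Walk (RemoveEdge G u v) u v
    mutual-visibility-bypass Y-visible u∈Y v∈Y w∈Y u≢v w≢u w≢v =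
      Visible⇒RemoveEdge-walk (inj₂ refl) v∈Y (≢-sym u≢v) (≢-sym w≢v) (Y-visible _ _ u∈Y w∈Y) ++ʷ
      Visible⇒RemoveEdge-walk (inj₁ refl) u∈Y (≢-sym w≢u) u≢v (Y-visible _ _ w∈Y v∈Y)

module Distance {n} (G : Graph n) (connected : Connected (Adj G)) where

  geodesic : ∀ a b → Walk (Adj G) a b
  geodesic a b = proj₁ (shortest (adj? G) (connected a b))

  geodesic-shortest : ∀ a b → IsShortest (geodesic a b)
  geodesic-shortest a b = proj₂ (shortest (adj? G) (connected a b))

  dist : Fin n → Fin n → ℕ
  dist a b = len (geodesic a b)

  dist-≤ : ∀ {a b} (q : Walk (Adj G) a b) → dist a b ≤ len q
  dist-≤ = geodesic-shortest _ _

  dist-refl : ∀ a → dist a a ≡ 0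
  dist-refl a = n≤0⇒n≡0 (dist-≤ [])

  dist≡0⇒≡ : ∀ {a b} → dist a b ≡ 0 → a ≡ b
  dist≡0⇒≡ = len≡0⇒≡ (geodesic _ _)

  dist>0 : ∀ {a b} → a ≢ b → 0 < dist a b
  dist>0 a≢b = n≢0⇒n>0 (a≢b ∘ dist≡0⇒≡)

  dist-adjacent : ∀ {s a b} → Adj G a b → dist s b ≤ suc (dist s a)
  dist-adjacent {s} {a} ab = begin
    dist s _                         ≤⟨ dist-≤ (geodesic s a ++ʷ (ab ∷ [])) ⟩
    len (geodesic s a ++ʷ (ab ∷ [])) ≡⟨ len-snoc (geodesic s a) ab ⟩
    suc (dist s a)                   ∎
    where open ≤-Reasoning

  geodesic-avoids : ∀ {a b c} → a ≢ c → dist a b ≤ dist c b → All (_≢ c) (verts (geodesic a b))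
  geodesic-avoids a≢c a-not-farther =
    no-longer-than-walks-from⇒avoids (geodesic _ _) a≢c (≤-trans a-not-farther ∘ dist-≤)

module _ {n} (G : Graph n) (u v : Fin n) (connected : Connected (Adj G)) (uv : Adj G u v) where

  open Distance G connected

  private
    X : Subset n
    X = ⁅ u ⁆ ∪ ⁅ v ⁆

    du dv : Fin n → ℕ
    du = dist u
    dv = dist v

    u≢v : u ≢ v
    u≢v refl = irrefl G uv

    u-closer-to-u : du u < dv u
    u-closer-to-u rewrite dist-refl u = dist>0 (≢-sym u≢v)

    v-not-closer-to-u : ¬ du v < dv v
    v-not-closer-to-u rewrite dist-refl v = n≮0

  module Crossing {x y} (xy : RemoveEdge G u v x y) (x-closer : du x < dv x)
                  (y-not-closer : dv y ≤ du y) where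

    Y : Subset n
    Y = X ∪ ⁅ y ⁆

    x≢v : x ≢ v
    x≢v refl = v-not-closer-to-u x-closer

    y≢u : y ≢ u
    y≢u refl = u≢v (≡.sym (dist≡0⇒≡ (n≤0⇒n≡0 (≤-trans y-not-closer (≤-reflexive (dist-refl u))))))

    y≢v : y ≢ v
    y≢v refl = proj₂ xy (inj₁ (≡.sym (dist≡0⇒≡ du-x≡0) , refl))
      where
      open ≤-Reasoning
      du-x≡0 : du x ≡ 0
      du-x≡0 = n<1⇒n≡0 (begin-strict
        du x           <⟨ x-closer ⟩
        dv x           ≤⟨ dist-adjacent (sym G (proj₁ xy)) ⟩
        suc (dv v)     ≡⟨ cong suc (dist-refl v) ⟩
        1              ∎)

    X⊂Y : X ⊂ Y
    X⊂Y = p⊆p∪q ⁅ y ⁆ , y , x∈p∪q⁺ (inj₂ (x∈⁅x⁆ y)) , Sum.[ y≢u , y≢v ] ∘ ∈-pair⁻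

    Y⁻ : ∀ {z} → z ∈ Y → (z ≡ u ⊎ z ≡ v) ⊎ z ≡ y
    Y⁻ = Sum.map ∈-pair⁻ (x∈⁅y⁆⇒x≡y y) ∘ x∈p∪q⁻ X ⁅ y ⁆

    Y-without-u : ∀ {z} → z ∈ Y → z ≢ u → z ≡ v ⊎ z ≡ y
    Y-without-u z∈Y z≢u with Y⁻ z∈Y
    ... | inj₁ (inj₁ z≡u) = ⊥-elim (z≢u z≡u)
    ... | inj₁ (inj₂ z≡v) = inj₁ z≡v
    ... | inj₂ z≡y = inj₂ z≡y

    Y-without-v : ∀ {z} → z ∈ Y → z ≢ v → z ≡ u ⊎ z ≡ y
    Y-without-v z∈Y z≢v with Y⁻ z∈Y
    ... | inj₁ (inj₁ z≡u) = inj₁ z≡u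
    ... | inj₁ (inj₂ z≡v) = ⊥-elim (z≢v z≡v)
    ... | inj₂ z≡y = inj₂ z≡y

    v-y-visible : Visible G Y v y
    v-y-visible = Visible-avoiding G (geodesic v y) (geodesic-shortest v y)
      (geodesic-avoids (≢-sym u≢v) y-not-closer) Y-without-u

    u-y-visible : Visible G Y u y
    u-y-visible with du y ≤? dv y
    ... | yes u-not-farther = Visible-avoiding G (geodesic u y) (geodesic-shortest u y)
      (geodesic-avoids u≢v u-not-farther) Y-without-v
    ... | no u-farther = Visible-avoiding G via-x via-x-shortest
      (All-++ (geodesic u x) _ (geodesic-avoids u≢v (<⇒≤ x-closer)) (x≢v ∷ y≢v ∷ []))
      Y-without-v
      where
      via-x : Walk (Adj G) u y
      via-x = geodesic u x ++ʷ (proj₁ xy ∷ [])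

      via-x-shortest : IsShortest via-x
      via-x-shortest q = begin
        len via-x  ≡⟨ len-snoc (geodesic u x) (proj₁ xy) ⟩
        suc (du x) ≤⟨ x-closer ⟩
        dv x       ≤⟨ dist-adjacent (sym G (proj₁ xy)) ⟩
        suc (dv y) ≤⟨ ≰⇒> u-farther ⟩
        du y       ≤⟨ dist-≤ q ⟩
        len q      ∎
        where open ≤-Reasoning

    Y-mutual-visibility : IsMutualVisibility G Y
    Y-mutual-visibility = IsMutualVisibility-∪⁅⁆ G (pair-visible G uv) y-visible
      where
      y-visible : ∀ {a} → a ∈ X → Visible G Y a y
      y-visible a∈X with ∈-pair⁻ a∈X
      ... | inj₁ refl = u-y-visible
      ... | inj₂ refl = v-y-visible

  maximal⇒cut-edge : IsMaximalMutualVisibility G X → IsCutEdge G u v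
  maximal⇒cut-edge (_ , maximal) = uv , λ G-uv-connected →
    let (x , y , xy , x-closer , y-not-closer) =
          crossing-edge (λ z → du z <? dv z) (G-uv-connected u v) u-closer-to-u v-not-closer-to-u
        open Crossing xy x-closer (≮⇒≥ y-not-closer)
    in maximal Y X⊂Y Y-mutual-visibility

  cut-edge⇒maximal : IsCutEdge G u v → IsMaximalMutualVisibility G X
  cut-edge⇒maximal (_ , G-uv-disconnected) = (λ _ _ → pair-visible G uv) , λ where
    Y (X⊆Y , w , w∈Y , w∉X) Y-visible → G-uv-disconnected (RemoveEdge-connected G connected
      (mutual-visibility-bypass G Y-visible (X⊆Y ∈-pairˡ) (X⊆Y ∈-pairʳ) w∈Y u≢v
        (λ { refl → w∉X ∈-pairˡ }) (λ { refl → w∉X ∈-pairʳ })))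

lemma4p3 : ∀ {n} (G : Graph n) (u v : Fin n) → Connected (Adj G) → Adj G u v →
    (IsMaximalMutualVisibility G (⁅ u ⁆ ∪ ⁅ v ⁆) ⇔ IsCutEdge G u v)
lemma4p3 G u v connected uv =
  mk⇔ (maximal⇒cut-edge G u v connected uv) (cut-edge⇒maximal G u v connected uv)
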